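{- Let $\mathcal{A}$ be a $\tau$-structure with universe $A$ such that each relation symbol in $\tau$ has arity at most $r$, and let $q\in\mathbb{N}$. Then the number of distinct reduced characteristic trees $\mathrm{RC}^q(\mathcal{A},\bar c,\bar C)$, over all possible choices of $\bar c$ and $\bar C$, is at most $\exp^{(q+1)}(|\tau|\cdot q^r + q\log q + q^2)$, and the size (number of nodes) of any reduced characteristic tree $\mathrm{RC}^q(\mathcal{A},\bar c,\bar C)$ is at most $\big(\exp^{(q)}(|\tau|\cdot q^r + q\log q + q^2)\big)^4$.
   Context: $\tau$ is a finite relational vocabulary. $\exp^{(0)}(x)=x$, $\exp^{(1)}(x)=2^x$, and $\exp^{(i)}(x) = 2^{2\exp^{(i-1)}(x)}$ for $i\geq 2$. For $\bar c = c_1,\ldots,c_m\in A^m$ and $\bar C = C_1,\ldots,C_p$ with $C_i\subseteq A$: $\mathcal{A}[\bar c]$ is the substructure induced on $\{c_1,\ldots,c_m\}$; $\equiv_{\bar c}$ is the equivalence relation on $[m]$ with $i\equiv_{\bar c}j$ iff $c_i=c_j$, with classes $[i]_{\bar c}$; $\mathrm{Ord}(\mathcal{A},\bar c)$ is the $\tau$-structure with universe $[m]/{\equiv_{\bar c}}$ such that $h\colon c_i\mapsto[i]_{\bar c}$ is an isomorphism from $\mathcal{A}[\bar c]$ onto it; $\mathrm{Ord}(\mathcal{A},\bar c,\bar C) = (\mathrm{Ord}(\mathcal{A},\bar c),\ [1]_{\bar c}\ldots[m]_{\bar c},\ h(C_1\cap\{c_1,\ldots,c_m\}),\ldots,h(C_p\cap\{c_1,\ldots,c_m\}))$.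 The reduced characteristic tree $\mathrm{RC}^q(\mathcal{A},\bar c,\bar C)$ is the finite rooted tree whose root is labeled $\mathrm{Ord}(\mathcal{A},\bar c,\bar C)$ and, if $m+p+1\leq q$, whose set of root subtrees is $\{\mathrm{RC}^q(\mathcal{A},\bar c d,\bar C): d\in A\}\cup\{\mathrm{RC}^q(\mathcal{A},\bar c,\bar C D): D\subseteq A\}$ (a set, so equal subtrees are identified); otherwise the root is a leaf. -}

module Defs where

open import Data.Nat using (ℕ; zero; suc; _+_; _*_; _∸_; _^_; _≟_)
open import Data.Bool using (Bool; true; false; _∧_; _∨_; if_then_else_)
open import Data.Fin using (Fin; zero; suc)
open import Data.Fin.Subset using (Subset)
open import Data.Vec using (Vec; []; _∷_; lookup; map; _∷ʳ_)
open import Data.List using (List; []; _∷_; _++_; concatMap; allFin)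
  renaming (map to mapL)
open import Relation.Nullary using (yes; no)
open import Relation.Binary.PropositionalEquality using (refl)

record Vocabulary : Set where
  field
    size  : ℕ
    arity : Fin size → ℕ
open Vocabulary public

open import Data.Nat using (_≤_)
MaxArity≤ : Vocabulary → ℕ → Set
MaxArity≤ τ r = (R : Fin (size τ)) → arity τ R ≤ r

record Structure (τ : Vocabulary) : Set where
  field
    n   : ℕ
    rel : (R : Fin (size τ)) → Vec (Fin n) (arity τ R) → Bool
open Structure public

allVecs : (m k : ℕ) → List (Vec (Fin m) k)
allVecs m zero    = [] ∷ []
allVecs m (suc k) = concatMap (λ i → mapL (i ∷_) (allVecs m k)) (allFin m)

allSubsets : (n : ℕ) → List (Subset n)
allSubsets zero    = [] ∷ []
allSubsets (suc n) = concatMap (λ D → (false ∷ D) ∷ (true ∷ D) ∷ []) (allSubsets n)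

allL : {X : Set} → (X → Bool) → List X → Bool
allL P []       = true
allL P (x ∷ xs) = P x ∧ allL P xs

-- Ord(A,c̄,C̄) is the structure with universe [m]/≡_c̄, constants [1],…,[m]
-- and unary predicates h(C_j ∩ c̄).  It is completely (and faithfully)
-- given by: m, p, the relation ≡_c̄ on [m], for every R and every index
-- tuple (i_1..i_k) ∈ [m]^k whether R holds of ([i_1],…,[i_k]) (i.e. of
-- (c_{i_1},…,c_{i_k}) in A, as h is an isomorphism), and for every j,i
-- whether [i] ∈ h(C_j ∩ c̄) (i.e. c_i ∈ C_j).  Two such labels are equal
-- as structures iff all this data coincides.
record Label (τ : Vocabulary) : Set where
  field
    m     : ℕ
    p     : ℕ
    eqv   : Fin m → Fin m → Bool
    rels  : (R : Fin (size τ)) → Vec (Fin m) (arity τ R) → Bool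
    preds : Fin p → Fin m → Bool
open Label public

_==F_ : {n : ℕ} → Fin n → Fin n → Bool
zero  ==F zero  = true
zero  ==F suc _ = false
suc _ ==F zero  = false
suc i ==F suc j = i ==F j

_==B_ : Bool → Bool → Bool
true  ==B b = b
false ==B true  = false
false ==B false = true

module _ (τ : Vocabulary) where

  sameData : (m p : ℕ)
    → (Fin m → Fin m → Bool) → ((R : Fin (size τ)) → Vec (Fin m) (arity τ R) → Bool)
    → (Fin p → Fin m → Bool)
    → (Fin m → Fin m → Bool) → ((R : Fin (size τ)) → Vec (Fin m) (arity τ R) → Bool)
    → (Fin p → Fin m → Bool) → Bool
  sameData m p e r pr e' r' pr' =
    allL (λ i → allL (λ j → e i j ==B e' i j) (allFin m)) (allFin m)
    ∧ allL (λ R → allL (λ ι → r R ι ==B r' R ι) (allVecs m (arity τ R))) (allFin (size τ))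
    ∧ allL (λ j → allL (λ i → pr j i ==B pr' j i) (allFin m)) (allFin p)

  eqLabel : Label τ → Label τ → Bool
  eqLabel record { m = m ; p = p ; eqv = e ; rels = r ; preds = pr }
          record { m = m' ; p = p' ; eqv = e' ; rels = r' ; preds = pr' }
    with m ≟ m' | p ≟ p'
  ... | yes refl | yes refl = sameData m p e r pr e' r' pr'
  ... | _        | _        = false

-- Finite rooted labelled trees, equality of trees whose children form a
-- SET (extensional, recursive), and number of nodes.

data Tree (L : Set) : Set where
  node : L → List (Tree L) → Tree L

module TreeOps {L : Set} (eqL : L → L → Bool) where
  mutual
    eqT : Tree L → Tree L → Bool
    eqT (node l ts) (node l' us) = eqL l l' ∧ (sub ts us ∧ sub us ts)

    sub : List (Tree L) → List (Tree L) → Bool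
    sub []       us = true
    sub (t ∷ ts) us = mem t us ∧ sub ts us

    mem : Tree L → List (Tree L) → Bool
    mem t []       = false
    mem t (u ∷ us) = eqT t u ∨ mem t us

  nubT : List (Tree L) → List (Tree L)
  nubT []       = []
  nubT (t ∷ ts) = if mem t ts then nubT ts else t ∷ nubT ts

  mutual
    nodes : Tree L → ℕ
    nodes (node _ ts) = suc (nodesL ts)

    nodesL : List (Tree L) → ℕ
    nodesL []       = 0
    nodesL (t ∷ ts) = nodes t + nodesL ts

module _ {τ : Vocabulary} (𝒜 : Structure τ) where

  open TreeOps (eqLabel τ)

  Univ : Set
  Univ = Fin (n 𝒜)

  ord : {m p : ℕ} → Vec Univ m → Vec (Subset (n 𝒜)) p → Label τ
  ord {m} {p} c C = record
    { m     = m
    ; p     = p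
    ; eqv   = λ i j → lookup c i ==F lookup c j
    ; rels  = λ R ι → rel 𝒜 R (map (lookup c) ι)
    ; preds = λ j i → lookup (lookup C j) (lookup c i)
    }

  -- rcFuel k c̄ C̄ : the tree RC^q(A,c̄,C̄) where k = q ∸ (m + p).
  -- The root has children iff m+p+1 ≤ q iff k ≥ 1; the children
  -- (c̄d, C̄) and (c̄, C̄D) have fuel q ∸ (m+p+1) = k - 1.
  -- The set of children is formed by removing duplicate subtrees.
  rcFuel : {m p : ℕ} → ℕ → Vec Univ m → Vec (Subset (n 𝒜)) p → Tree (Label τ)
  rcFuel zero    c C = node (ord c C) []
  rcFuel (suc k) c C = node (ord c C) (nubT
    (mapL (λ d → rcFuel k (c ∷ʳ d) C) (allFin (n 𝒜))
     ++ mapL (λ D → rcFuel k c (C ∷ʳ D)) (allSubsets (n 𝒜))))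

  RC : (q : ℕ) → {m p : ℕ} → Vec Univ m → Vec (Subset (n 𝒜)) p → Tree (Label τ)
  RC q {m} {p} c C = rcFuel (q ∸ (m + p)) c C

-- Towers.  exp⁽⁰⁾(x) = x, exp⁽¹⁾(x) = 2^x, exp⁽ⁱ⁾(x) = 2^(2·exp⁽ⁱ⁻¹⁾(x)).
-- expAbove i y = exp⁽ⁱ⁺¹⁾(x) where y = 2^x = exp⁽¹⁾(x).
expAbove : ℕ → ℕ → ℕ
expAbove zero    y = y
expAbove (suc i) y = 2 ^ (2 * expAbove i y)

-- For q ≥ 1 and x = |τ|·q^r + q·log₂ q + q²  (a real number in general),
-- 2^x = 2^(|τ|·q^r + q²) · q^q exactly, a natural number.
twoToX : (s q r : ℕ) → ℕ
twoToX s q r = 2 ^ (s * q ^ r + q * q) * q ^ q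

module Submission where

-- RC^q(A,c̄,C̄) with |c̄| = m, |C̄| = p is a tree of depth k = q ∸ (m + p)
-- whose root label Ord(A,c̄,C̄) has shape (m , p) and whose children form a
-- list, repetition-free up to tree equality, of such trees of depth k - 1 at
-- shape (m+1 , p) or (m , p+1).  We call these trees `Shaped' and count them
-- without reference to A:
--   * labels of shape (m , p) are enumerated up to eqLabel by a list of
--     length at most 2^(m² + |τ|·q^r + m·p) ≤ Λ = 2^(|τ|·q^r + q²);
--   * shaped trees of depth k are enumerated up to eqT by `Enum', a label
--     together with a sublist of candidate children, so there are at most
--     U k of them, where U 0 = Λ and U (k+1) = Λ·2^(2·U k);
--   * by a pigeonhole argument a repetition-free list covered by a list K
--     is no longer than K, so a shaped tree has at most W k ≤ (2·U (k-1))²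
--     nodes.
-- Finally U is compared with the tower: 2·U k ≤ exp⁽ᵏ⁺¹⁾(x) when q ≥ 2,
-- while for q = 1 the three levels are counted exactly.

open import Defs
open import Data.Nat using (ℕ; zero; suc; _+_; _*_; _∸_; _^_; _≤_; _<_; z≤n; s≤s; _≟_)
open import Data.Nat.Properties
open import Data.Nat.Tactic.RingSolver using (solve-∀)
open import Data.Bool using (Bool; true; false; _∧_; _∨_)
open import Data.Bool.Properties using (∧-conicalˡ; ∧-conicalʳ; ∨-zeroʳ) renaming (_≟_ to _≟B_)
open import Data.Fin using (Fin)
open import Data.Fin.Properties using () renaming (_≟_ to _≟F_)
open import Data.Vec using (Vec; _∷ʳ_)
open import Data.Fin.Subset using (Subset)
import Data.Vec as Vec
open import Data.Vec.Properties using (≡-dec)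
open import Data.List using (List; []; _∷_; _++_; length; map; concatMap; allFin; filter; upTo)
open import Data.Nat.ListAction using (sum)
open import Data.List.Properties using (length-++; length-map; length-tabulate; filter-notAll; length-upTo)
open import Data.List.Membership.Propositional.Properties
  using (∈-++⁺ˡ; ∈-++⁺ʳ; ∈-++⁻; ∈-concatMap⁺; ∈-map⁺; ∈-map⁻; ∈-filter⁺; ∈-filter⁻; ∈-upTo⁺; ∈-upTo⁻)
open import Data.List.Membership.Propositional using (_∈_; lose)
open import Data.List.Relation.Binary.Subset.Propositional using (_⊆_)
open import Data.List.Relation.Unary.Any using (here; there)
open import Data.Product using (Σ; _×_; _,_; proj₂)
open import Data.Empty using (⊥; ⊥-elim)
open import Data.Sum using (_⊎_; inj₁; inj₂)
open import Relation.Nullary using (yes; no; does)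
open import Relation.Unary using (Decidable)
open import Relation.Binary.Definitions using (DecidableEquality)
open import Relation.Binary.PropositionalEquality
open import Function using (_∘_; id; const)

∧-intro : ∀ {a b} → a ≡ true → b ≡ true → a ∧ b ≡ true
∧-intro = cong₂ _∧_

false≢true : false ≡ true → ⊥
false≢true ()

==B-sound : ∀ a b → (a ==B b) ≡ true → a ≡ b
==B-sound true  true  _ = refl
==B-sound false false _ = refl

==B-complete : ∀ a b → a ≡ b → (a ==B b) ≡ true
==B-complete true  .true  refl = refl
==B-complete false .false refl = refl

module _ {X : Set} (P : X → Bool) where

  allL-sound : ∀ {xs} → allL P xs ≡ true → ∀ {x} → x ∈ xs → P x ≡ true
  allL-sound {y ∷ ys} h (here refl) = ∧-conicalˡ (P y) _ h
  allL-sound {y ∷ ys} h (there x∈)  = allL-sound (∧-conicalʳ (P y) _ h) x∈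

  allL-complete : ∀ xs → (∀ {x} → x ∈ xs → P x ≡ true) → allL P xs ≡ true
  allL-complete []       h = refl
  allL-complete (x ∷ xs) h = ∧-intro (h (here refl)) (allL-complete xs (h ∘ there))

Agree : {X : Set} {Y : X → Set} → List X → ((x : X) → List (Y x))
      → (f g : (x : X) → Y x → Bool) → Set
Agree xs ys f g = ∀ {x} → x ∈ xs → ∀ {y} → y ∈ ys x → f x y ≡ g x y

agreeB : {X : Set} {Y : X → Set} → List X → ((x : X) → List (Y x))
       → (f g : (x : X) → Y x → Bool) → Bool
agreeB xs ys f g = allL (λ x → allL (λ y → f x y ==B g x y) (ys x)) xs

module _ {X : Set} {Y : X → Set} (xs : List X) (ys : (x : X) → List (Y x)) where

  agreeB-sound : ∀ f g → agreeB xs ys f g ≡ true → Agree xs ys f g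
  agreeB-sound f g h {x} x∈ y∈ =
    ==B-sound (f x _) (g x _) (allL-sound _ (allL-sound _ h x∈) y∈)

  agreeB-complete : ∀ f g → Agree xs ys f g → agreeB xs ys f g ≡ true
  agreeB-complete f g h = allL-complete _ xs λ {x} x∈ →
    allL-complete _ (ys x) λ y∈ → ==B-complete (f x _) (g x _) (h x∈ y∈)

module _ {X : Set} {Y : X → Set} {xs : List X} {ys : (x : X) → List (Y x)} where

  Agree-sym : ∀ {f g} → Agree xs ys f g → Agree xs ys g f
  Agree-sym h x∈ y∈ = sym (h x∈ y∈)

  Agree-trans : ∀ {f g h} → Agree xs ys f g → Agree xs ys g h → Agree xs ys f h
  Agree-trans h h' x∈ y∈ = trans (h x∈ y∈) (h' x∈ y∈)

Covered : {X : Set} → (X → X → Bool) → List X → X → Set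
Covered eq K x = Σ _ λ u → u ∈ K × eq x u ≡ true

length-concatMap : {X Y : Set} (f : X → List Y) (xs : List X)
                 → length (concatMap f xs) ≡ sum (map (length ∘ f) xs)
length-concatMap f []       = refl
length-concatMap f (x ∷ xs) = trans (length-++ (f x)) (cong (length (f x) +_) (length-concatMap f xs))

length-concatMap-≤ : {X Y : Set} (f : X → List Y) (xs : List X) (B : ℕ)
                   → (∀ {x} → x ∈ xs → length (f x) ≤ B) → length (concatMap f xs) ≤ length xs * B
length-concatMap-≤ f xs B h = ≤-trans (≤-reflexive (length-concatMap f xs)) (sum≤ xs h)
  where
  sum≤ : ∀ xs → (∀ {x} → x ∈ xs → length (f x) ≤ B) → sum (map (length ∘ f) xs) ≤ length xs * B
  sum≤ []       h = z≤n
  sum≤ (x ∷ xs) h = +-mono-≤ (h (here refl)) (sum≤ xs (h ∘ there))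

∈-concatMap : {X Y : Set} (f : X → List Y) {x : X} {y : Y} {xs : List X}
            → y ∈ f x → x ∈ xs → y ∈ concatMap f xs
∈-concatMap f y∈ x∈ = ∈-concatMap⁺ f (lose x∈ y∈)

sublists : {X : Set} → List X → List (List X)
sublists []       = [] ∷ []
sublists (x ∷ xs) = concatMap (λ s → s ∷ (x ∷ s) ∷ []) (sublists xs)

filter-∈-sublists : {X : Set} {P : X → Set} (P? : Decidable P) (xs : List X) → filter P? xs ∈ sublists xs
filter-∈-sublists P? []       = here refl
filter-∈-sublists P? (x ∷ xs) with does (P? x)
... | true  = ∈-concatMap (λ s → s ∷ (x ∷ s) ∷ []) (there (here refl)) (filter-∈-sublists P? xs)
... | false = ∈-concatMap (λ s → s ∷ (x ∷ s) ∷ []) (here refl) (filter-∈-sublists P? xs)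

length-sublists : {X : Set} (xs : List X) → length (sublists xs) ≤ 2 ^ length xs
length-sublists []       = ≤-refl
length-sublists (x ∷ xs) = begin
  length (sublists (x ∷ xs))   ≤⟨ length-concatMap-≤ _ (sublists xs) 2 (λ _ → ≤-refl) ⟩
  length (sublists xs) * 2     ≤⟨ *-monoˡ-≤ 2 (length-sublists xs) ⟩
  2 ^ length xs * 2            ≡⟨ *-comm (2 ^ length xs) 2 ⟩
  2 ^ suc (length xs)          ∎
  where open ≤-Reasoning

module _ {X : Set} {Y : X → Set} (_≟X_ : DecidableEquality X) where

  update : (x : X) → Y x → ((z : X) → Y z) → (z : X) → Y z
  update x y g z with z ≟X x
  ... | yes refl = y
  ... | no _     = g z

  functions : List X → ((x : X) → List (Y x)) → ((x : X) → Y x) → List ((x : X) → Y x)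
  functions []       cod d = d ∷ []
  functions (x ∷ xs) cod d = concatMap (λ y → map (update x y) (functions xs cod d)) (cod x)

  functions-complete : ∀ xs cod d (R : (x : X) → Y x → Y x → Set) (f : (x : X) → Y x)
    → (∀ x → Σ (Y x) λ y → y ∈ cod x × R x (f x) y)
    → Σ ((x : X) → Y x) λ g → g ∈ functions xs cod d × (∀ {x} → x ∈ xs → R x (f x) (g x))
  functions-complete []       cod d R f h = d , here refl , λ ()
  functions-complete (x ∷ xs) cod d R f h
    with g , g∈ , f≈g ← functions-complete xs cod d R f h | y , y∈ , fx≈y ← h x =
    update x y g ,
    ∈-concatMap (λ y → map (update x y) (functions xs cod d)) (∈-map⁺ (update x y) g∈) y∈ ,
    agrees
    where
    agrees : ∀ {z} → z ∈ x ∷ xs → R z (f z) (update x y g z)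
    agrees {z} z∈ with z ≟X x
    agrees _            | yes refl = fx≈y
    agrees (here refl)  | no z≢x   = ⊥-elim (z≢x refl)
    agrees (there z∈xs) | no _     = f≈g z∈xs

  length-functions : ∀ xs cod d B → (∀ x → length (cod x) ≤ B) → length (functions xs cod d) ≤ B ^ length xs
  length-functions []       cod d B h = ≤-refl
  length-functions (x ∷ xs) cod d B h =
    ≤-trans (length-concatMap-≤ _ (cod x) (B ^ length xs) λ {y} _ →
               ≤-trans (≤-reflexive (length-map (update x y) (functions xs cod d)))
                       (length-functions xs cod d B h))
            (*-monoˡ-≤ (B ^ length xs) (h x))

bools : List Bool
bools = false ∷ true ∷ []

∈-bools : ∀ b → b ∈ bools
∈-bools false = here refl
∈-bools true  = there (here refl)

module _ {X : Set} (_≟X_ : DecidableEquality X) where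

  predicates : List X → List (X → Bool)
  predicates xs = functions _≟X_ xs (const bools) (const false)

  predicates-complete : ∀ xs (f : X → Bool) → Σ (X → Bool) λ g → g ∈ predicates xs × (∀ {x} → x ∈ xs → f x ≡ g x)
  predicates-complete xs f = functions-complete _≟X_ xs _ _ (λ _ → _≡_) f (λ x → f x , ∈-bools (f x) , refl)

  length-predicates : ∀ xs → length (predicates xs) ≤ 2 ^ length xs
  length-predicates xs = length-functions _≟X_ xs _ _ 2 (λ _ → ≤-refl)

module _ {X : Set} {Y : X → Set} (_≟X_ : DecidableEquality X) (_≟Y_ : ∀ {x} → DecidableEquality (Y x)) where

  relations : List X → ((x : X) → List (Y x)) → List ((x : X) → Y x → Bool)
  relations xs ys = functions _≟X_ xs (λ x → predicates _≟Y_ (ys x)) (λ _ _ → false)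

  relations-complete : ∀ xs ys f → Σ ((x : X) → Y x → Bool) λ g → g ∈ relations xs ys × Agree xs ys f g
  relations-complete xs ys f =
    functions-complete _≟X_ xs _ _ (λ x f₁ g₁ → ∀ {y} → y ∈ ys x → f₁ y ≡ g₁ y) f
                       (λ x → predicates-complete _≟Y_ (ys x) (f x))

  length-relations : ∀ xs ys N → (∀ x → length (ys x) ≤ N) → length (relations xs ys) ≤ 2 ^ (N * length xs)
  length-relations xs ys N h = begin
    length (relations xs ys)   ≤⟨ length-functions _≟X_ xs _ _ (2 ^ N) (λ x →
                                    ≤-trans (length-predicates _≟Y_ (ys x)) (^-monoʳ-≤ 2 (h x))) ⟩
    (2 ^ N) ^ length xs        ≡⟨ ^-*-assoc 2 N (length xs) ⟩
    2 ^ (N * length xs)        ∎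
    where open ≤-Reasoning

length-allFin : ∀ m → length (allFin m) ≡ m
length-allFin m = length-tabulate {n = m} id

length-allVecs : ∀ m k → length (allVecs m k) ≤ m ^ k
length-allVecs m zero    = ≤-refl
length-allVecs m (suc k) =
  ≤-trans (length-concatMap-≤ _ (allFin m) (m ^ k) λ {i} _ →
             ≤-trans (≤-reflexive (length-map (i Vec.∷_) (allVecs m k))) (length-allVecs m k))
          (≤-reflexive (cong (_* m ^ k) (length-allFin m)))

module Labels (τ : Vocabulary) where

  Rels : ℕ → Set
  Rels m = (R : Fin (size τ)) → Vec (Fin m) (arity τ R) → Bool

  mkLabel : (m p : ℕ) → (Fin m → Fin m → Bool) → Rels m → (Fin p → Fin m → Bool) → Label τ
  mkLabel m p e r pr = record { m = m ; p = p ; eqv = e ; rels = r ; preds = pr }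

  tuples : (m : ℕ) (R : Fin (size τ)) → List (Vec (Fin m) (arity τ R))
  tuples m R = allVecs m (arity τ R)

  data _≅_ : Label τ → Label τ → Set where
    agree : ∀ {m p e r pr e′ r′ pr′}
          → Agree (allFin m) (const (allFin m)) e e′
          → Agree (allFin (size τ)) (tuples m) r r′
          → Agree (allFin p) (const (allFin m)) pr pr′
          → mkLabel m p e r pr ≅ mkLabel m p e′ r′ pr′

  ≅-sym : ∀ {l l′} → l ≅ l′ → l′ ≅ l
  ≅-sym (agree a b c) = agree (Agree-sym a) (Agree-sym b) (Agree-sym c)

  ≅-trans : ∀ {l l′ l″} → l ≅ l′ → l′ ≅ l″ → l ≅ l″
  ≅-trans (agree a b c) (agree a′ b′ c′) =
    agree (Agree-trans a a′) (Agree-trans b b′) (Agree-trans c c′)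

  eqLabel-sameShape : ∀ m p e r pr e′ r′ pr′
    → eqLabel τ (mkLabel m p e r pr) (mkLabel m p e′ r′ pr′) ≡ sameData τ m p e r pr e′ r′ pr′
  eqLabel-sameShape m p _ _ _ _ _ _ with m ≟ m | p ≟ p
  ... | yes refl | yes refl = refl
  ... | no m≢m   | _        = ⊥-elim (m≢m refl)
  ... | yes refl | no p≢p   = ⊥-elim (p≢p refl)

  sameData-sound : ∀ m p e r pr e′ r′ pr′
    → sameData τ m p e r pr e′ r′ pr′ ≡ true → mkLabel m p e r pr ≅ mkLabel m p e′ r′ pr′
  sameData-sound m p e r pr e′ r′ pr′ h =
    agree (agreeB-sound (allFin m) (const (allFin m)) e e′ (∧-conicalˡ eqvs _ h))
          (agreeB-sound (allFin (size τ)) (tuples m) r r′ (∧-conicalˡ relsB predsB (∧-conicalʳ eqvs _ h)))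
          (agreeB-sound (allFin p) (const (allFin m)) pr pr′ (∧-conicalʳ relsB predsB (∧-conicalʳ eqvs _ h)))
    where
    eqvs   = agreeB (allFin m) (const (allFin m)) e e′
    relsB  = agreeB (allFin (size τ)) (tuples m) r r′
    predsB = agreeB (allFin p) (const (allFin m)) pr pr′

  sameData-complete : ∀ {m p e r pr e′ r′ pr′}
    → mkLabel m p e r pr ≅ mkLabel m p e′ r′ pr′ → sameData τ m p e r pr e′ r′ pr′ ≡ true
  sameData-complete {m} {p} {e} {r} {pr} {e′} {r′} {pr′} (agree a b c) =
    ∧-intro (agreeB-complete (allFin m) (const (allFin m)) e e′ a)
      (∧-intro (agreeB-complete (allFin (size τ)) (tuples m) r r′ b)
               (agreeB-complete (allFin p) (const (allFin m)) pr pr′ c))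

  eqLabel-complete : ∀ {l l′} → l ≅ l′ → eqLabel τ l l′ ≡ true
  eqLabel-complete l≅l′@(agree {m} {p} {e} {r} {pr} {e′} {r′} {pr′} _ _ _) =
    trans (eqLabel-sameShape m p e r pr e′ r′ pr′) (sameData-complete l≅l′)

  eqLabel-sound : ∀ l l′ → eqLabel τ l l′ ≡ true → l ≅ l′
  eqLabel-sound record { m = m ; p = p ; eqv = e ; rels = r ; preds = pr }
                record { m = m′ ; p = p′ ; eqv = e′ ; rels = r′ ; preds = pr′ } h
    with m ≟ m′ | p ≟ p′
  ... | yes refl | yes refl = sameData-sound m p e r pr e′ r′ pr′ h
  ... | no _     | _        = ⊥-elim (false≢true h)
  ... | yes refl | no _     = ⊥-elim (false≢true h)

  eqLabel-sym : ∀ l l′ → eqLabel τ l l′ ≡ true → eqLabel τ l′ l ≡ true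
  eqLabel-sym l l′ = eqLabel-complete ∘ ≅-sym ∘ eqLabel-sound l l′

  eqLabel-trans : ∀ l l′ l″ → eqLabel τ l l′ ≡ true → eqLabel τ l′ l″ ≡ true → eqLabel τ l l″ ≡ true
  eqLabel-trans l l′ l″ h h′ = eqLabel-complete (≅-trans (eqLabel-sound l l′ h) (eqLabel-sound l′ l″ h′))

  equivalences : (m : ℕ) → List (Fin m → Fin m → Bool)
  equivalences m = relations _≟F_ _≟F_ (allFin m) (const (allFin m))

  relationTables : (m : ℕ) → List (Rels m)
  relationTables m = relations _≟F_ (≡-dec _≟F_) (allFin (size τ)) (tuples m)

  predicateTables : (m p : ℕ) → List (Fin p → Fin m → Bool)
  predicateTables m p = relations _≟F_ _≟F_ (allFin p) (const (allFin m))

  allLabels : ℕ → ℕ → List (Label τ)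
  allLabels m p =
    concatMap (λ e → concatMap (λ r → map (mkLabel m p e r) (predicateTables m p))
                               (relationTables m))
              (equivalences m)

  allLabels-complete : (l : Label τ) → Covered (eqLabel τ) (allLabels (Label.m l) (Label.p l)) l
  allLabels-complete record { m = m ; p = p ; eqv = e ; rels = r ; preds = pr }
    with e′ , e′∈ , e≈e′ ← relations-complete _≟F_ _≟F_ (allFin m) (const (allFin m)) e
       | r′ , r′∈ , r≈r′ ← relations-complete _≟F_ (≡-dec _≟F_) (allFin (size τ)) (tuples m) r
       | pr′ , pr′∈ , pr≈pr′ ← relations-complete _≟F_ _≟F_ (allFin p) (const (allFin m)) pr
    = mkLabel m p e′ r′ pr′ ,
      ∈-concatMap _ (∈-concatMap _ (∈-map⁺ (mkLabel m p e′ r′) pr′∈) r′∈) e′∈ ,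
      eqLabel-complete (agree e≈e′ r≈r′ pr≈pr′)

  length-allLabels : ∀ m p Q → (∀ R → m ^ arity τ R ≤ Q)
                   → length (allLabels m p) ≤ 2 ^ (m * m + (Q * size τ + m * p))
  length-allLabels m p Q h = begin
    length (allLabels m p)
      ≤⟨ length-concatMap-≤ _ (equivalences m) _ (λ _ →
           length-concatMap-≤ _ (relationTables m) _ (λ _ → ≤-reflexive (length-map _ (predicateTables m p)))) ⟩
    length (equivalences m) * (length (relationTables m) * length (predicateTables m p))
      ≤⟨ *-mono-≤ #equivalences (*-mono-≤ #relationTables #predicateTables) ⟩
    2 ^ (m * m) * (2 ^ (Q * size τ) * 2 ^ (m * p))
      ≡⟨ sym (trans (^-distribˡ-+-* 2 (m * m) _) (cong (2 ^ (m * m) *_) (^-distribˡ-+-* 2 (Q * size τ) (m * p)))) ⟩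
    2 ^ (m * m + (Q * size τ + m * p)) ∎
    where
    open ≤-Reasoning
    #equivalences : length (equivalences m) ≤ 2 ^ (m * m)
    #equivalences = ≤-trans
      (length-relations _≟F_ _≟F_ (allFin m) (const (allFin m)) m (λ _ → ≤-reflexive (length-allFin m)))
      (≤-reflexive (cong (λ k → 2 ^ (m * k)) (length-allFin m)))
    #relationTables : length (relationTables m) ≤ 2 ^ (Q * size τ)
    #relationTables = ≤-trans
      (length-relations _≟F_ (≡-dec _≟F_) (allFin (size τ)) (tuples m) Q
         (λ R → ≤-trans (length-allVecs m (arity τ R)) (h R)))
      (≤-reflexive (cong (λ k → 2 ^ (Q * k)) (length-allFin (size τ))))
    #predicateTables : length (predicateTables m p) ≤ 2 ^ (m * p)
    #predicateTables = ≤-trans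
      (length-relations _≟F_ _≟F_ (allFin p) (const (allFin m)) m (λ _ → ≤-reflexive (length-allFin m)))
      (≤-reflexive (cong (λ k → 2 ^ (m * k)) (length-allFin p)))

  length-allLabels-≤1 : ∀ m p → m + p ≤ 1 → length (allLabels m p) ≤ 2 ^ (m + size τ)
  length-allLabels-≤1 m p m+p≤1 =
    ≤-trans (length-allLabels m p 1 tuples≤1)
            (^-monoʳ-≤ 2 (≤-trans (≤-reflexive (regroup m p (size τ))) (+-monoˡ-≤ (size τ) m[m+p]≤m)))
    where
    m≤1 = m+n≤o⇒m≤o m m+p≤1
    tuples≤1 : ∀ R → m ^ arity τ R ≤ 1
    tuples≤1 R = ≤-trans (^-monoˡ-≤ (arity τ R) m≤1) (≤-reflexive (^-zeroˡ (arity τ R)))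
    m[m+p]≤m : m * (m + p) ≤ m
    m[m+p]≤m = ≤-trans (*-monoʳ-≤ m m+p≤1) (≤-reflexive (*-identityʳ m))
    regroup : ∀ m p s → m * m + (1 * s + m * p) ≡ m * (m + p) + s
    regroup = solve-∀

-- The recursive bounds: at most U Λ k trees of depth k at any level and
-- at most W Λ k nodes in each, when every level has at most Λ labels.

U : ℕ → ℕ → ℕ
U Λ zero    = Λ
U Λ (suc k) = Λ * 2 ^ (U Λ k + U Λ k)

W : ℕ → ℕ → ℕ
W Λ zero    = 1
W Λ (suc k) = suc ((U Λ k + U Λ k) * W Λ k)

module Trees {L : Set} (eqL : L → L → Bool)
  (eqL-sym   : ∀ l l′ → eqL l l′ ≡ true → eqL l′ l ≡ true)
  (eqL-trans : ∀ l l′ l″ → eqL l l′ ≡ true → eqL l′ l″ ≡ true → eqL l l″ ≡ true) where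

  open TreeOps eqL

  mem-sound : ∀ t us → mem t us ≡ true → Covered eqT us t
  mem-sound t (u ∷ us) h with eqT t u in t≈u
  ... | true  = u , here refl , t≈u
  ... | false with v , v∈ , t≈v ← mem-sound t us h = v , there v∈ , t≈v

  mem-there : ∀ t v vs → mem t vs ≡ true → mem t (v ∷ vs) ≡ true
  mem-there t v vs h = trans (cong (eqT t v ∨_) h) (∨-zeroʳ _)

  mem-complete : ∀ t {u us} → u ∈ us → eqT t u ≡ true → mem t us ≡ true
  mem-complete t (here refl)                  t≈u = cong (_∨ _) t≈u
  mem-complete t (there {x = v} {xs = vs} u∈) t≈u = mem-there t v vs (mem-complete t u∈ t≈u)

  sub-sound : ∀ ts us → sub ts us ≡ true → ∀ {t} → t ∈ ts → mem t us ≡ true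
  sub-sound (t ∷ ts) us h (here refl) = ∧-conicalˡ (mem t us) _ h
  sub-sound (t ∷ ts) us h (there t∈)  = sub-sound ts us (∧-conicalʳ (mem t us) _ h) t∈

  sub-complete : ∀ ts {us} → (∀ {t} → t ∈ ts → mem t us ≡ true) → sub ts us ≡ true
  sub-complete []       h = refl
  sub-complete (t ∷ ts) h = ∧-intro (h (here refl)) (sub-complete ts (h ∘ there))

  eqT-sym : ∀ t u → eqT t u ≡ true → eqT u t ≡ true
  eqT-sym (node l ts) (node l′ us) h =
    ∧-intro (eqL-sym l l′ (∧-conicalˡ (eqL l l′) _ h))
            (∧-intro (∧-conicalʳ (sub ts us) _ children) (∧-conicalˡ (sub ts us) _ children))
    where children = ∧-conicalʳ (eqL l l′) _ h

  mutual
    eqT-trans : ∀ t u v → eqT t u ≡ true → eqT u v ≡ true → eqT t v ≡ true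
    eqT-trans (node l ts) (node l′ us) (node l″ vs) h h′ =
      ∧-intro (eqL-trans l l′ l″ (∧-conicalˡ (eqL l l′) _ h) (∧-conicalˡ (eqL l′ l″) _ h′))
        (∧-intro (sub-trans ts us vs (∧-conicalˡ (sub ts us) _ c) (∧-conicalˡ (sub us vs) _ c′))
                 (sub-trans vs us ts (∧-conicalʳ (sub us vs) _ c′) (∧-conicalʳ (sub ts us) _ c)))
      where
      c  = ∧-conicalʳ (eqL l l′) _ h
      c′ = ∧-conicalʳ (eqL l′ l″) _ h′

    sub-trans : ∀ ts us vs → sub ts us ≡ true → sub us vs ≡ true → sub ts vs ≡ true
    sub-trans []       _  _  _ _  = refl
    sub-trans (t ∷ ts) us vs h h′ =
      ∧-intro (mem-trans t us vs (∧-conicalˡ (mem t us) _ h) h′)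
              (sub-trans ts us vs (∧-conicalʳ (mem t us) _ h) h′)

    mem-trans : ∀ t us vs → mem t us ≡ true → sub us vs ≡ true → mem t vs ≡ true
    mem-trans t (u ∷ us) vs h h′ with eqT t u in t≈u
    ... | true  = mem-trans′ t u vs t≈u (∧-conicalˡ (mem u vs) _ h′)
    ... | false = mem-trans t us vs h (∧-conicalʳ (mem u vs) _ h′)

    mem-trans′ : ∀ t u vs → eqT t u ≡ true → mem u vs ≡ true → mem t vs ≡ true
    mem-trans′ t u (v ∷ vs) t≈u h with eqT u v in u≈v
    ... | true  = mem-complete t {us = v ∷ vs} (here refl) (eqT-trans t u v t≈u u≈v)
    ... | false = mem-there t v vs (mem-trans′ t u vs t≈u h)

  nubT-⊆ : ∀ ts → nubT ts ⊆ ts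
  nubT-⊆ (u ∷ ts) t∈ with mem u ts
  ... | true = there (nubT-⊆ ts t∈)
  nubT-⊆ (u ∷ ts) (here refl) | false = here refl
  nubT-⊆ (u ∷ ts) (there t∈)  | false = there (nubT-⊆ ts t∈)

  data Distinct : List (Tree L) → Set where
    []  : Distinct []
    _∷_ : ∀ {t ts} → mem t ts ≡ false → Distinct ts → Distinct (t ∷ ts)

  mem-⊆ : ∀ t {ts us} → ts ⊆ us → mem t ts ≡ true → mem t us ≡ true
  mem-⊆ t {ts} ts⊆us h with u , u∈ , t≈u ← mem-sound t ts h = mem-complete t (ts⊆us u∈) t≈u

  nubT-distinct : ∀ ts → Distinct (nubT ts)
  nubT-distinct []       = []
  nubT-distinct (t ∷ ts) with mem t ts in t∉ts
  ... | true  = nubT-distinct ts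
  ... | false = fresh ∷ nubT-distinct ts
    where
    fresh : mem t (nubT ts) ≡ false
    fresh with mem t (nubT ts) in t∈nub
    ... | false = refl
    ... | true  = trans (sym (mem-⊆ t (nubT-⊆ ts) t∈nub)) t∉ts

  -- Covering the head by k, the tail is covered by
  -- the members of K inequivalent to the head, a list lacking k.

  distinct-covered-≤ : ∀ ts K → Distinct ts → (∀ {t} → t ∈ ts → Covered eqT K t) → length ts ≤ length K
  distinct-covered-≤ []       K _           _   = z≤n
  distinct-covered-≤ (t ∷ ts) K (t∉ts ∷ distinct) cov
    with k , k∈ , t≈k ← cov (here refl) =
    ≤-trans (s≤s (distinct-covered-≤ ts K′ distinct cov′))
            (filter-notAll apart? K (lose k∈ λ t≉k → false≢true (trans (sym t≉k) t≈k)))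
    where
    apart? : Decidable (λ u → eqT t u ≡ false)
    apart? u = eqT t u ≟B false
    K′ = filter apart? K
    cov′ : ∀ {t′} → t′ ∈ ts → Covered eqT K′ t′
    cov′ {t′} t′∈ with u , u∈ , t′≈u ← cov (there t′∈) = u , ∈-filter⁺ apart? u∈ t≉u , t′≈u
      where
      t≉u : eqT t u ≡ false
      t≉u with eqT t u in t≈u
      ... | false = refl
      ... | true  = trans (sym (mem-complete t t′∈ (eqT-trans t u t′ t≈u (eqT-sym t′ u t′≈u)))) t∉ts

  nodesL-≤ : ∀ ts B → (∀ {t} → t ∈ ts → nodes t ≤ B) → nodesL ts ≤ length ts * B
  nodesL-≤ []       B h = z≤n
  nodesL-≤ (t ∷ ts) B h = +-mono-≤ (h (here refl)) (nodesL-≤ ts B (h ∘ there))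

  module Enumeration (labels : ℕ → ℕ → List L) where

    data Shaped : ℕ → ℕ → ℕ → Tree L → Set where
      leaf  : ∀ {m p l} → Covered eqL (labels m p) l → Shaped zero m p (node l [])
      inner : ∀ {k m p l ts} → Covered eqL (labels m p) l → Distinct ts
            → (∀ {t} → t ∈ ts → Shaped k (suc m) p t ⊎ Shaped k m (suc p) t)
            → Shaped (suc k) m p (node l ts)

    mutual
      Enum : ℕ → ℕ → ℕ → List (Tree L)
      Enum zero    m p = map (λ l → node l []) (labels m p)
      Enum (suc k) m p = concatMap (λ l → map (node l) (sublists (Children k m p))) (labels m p)

      Children : ℕ → ℕ → ℕ → List (Tree L)
      Children k m p = Enum k (suc m) p ++ Enum k m (suc p)

    -- Every shaped tree is equivalent to an enumerated one: keep the
    -- root label's representative and those candidates equivalent to a child.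

    mutual
      Enum-complete : ∀ {k m p t} → Shaped k m p t → Covered eqT (Enum k m p) t
      Enum-complete (leaf (l′ , l′∈ , l≈l′)) = node l′ [] , ∈-map⁺ _ l′∈ , ∧-intro l≈l′ refl
      Enum-complete {suc k} {m} {p} {node l ts} (inner (l′ , l′∈ , l≈l′) _ shaped) =
        node l′ S ,
        ∈-concatMap _ (∈-map⁺ (node l′) (filter-∈-sublists kept? (Children k m p))) l′∈ ,
        ∧-intro l≈l′ (∧-intro (sub-complete ts ts⊆S) (sub-complete S S⊆ts))
        where
        kept? : Decidable (λ u → mem u ts ≡ true)
        kept? u = mem u ts ≟B true
        S = filter kept? (Children k m p)
        ts⊆S : ∀ {t} → t ∈ ts → mem t S ≡ true
        ts⊆S {t} t∈ with u , u∈ , t≈u ← Child-complete (shaped t∈) =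
          mem-complete t (∈-filter⁺ kept? u∈ (mem-complete u t∈ (eqT-sym t u t≈u))) t≈u
        S⊆ts : ∀ {u} → u ∈ S → mem u ts ≡ true
        S⊆ts u∈ = proj₂ (∈-filter⁻ kept? {xs = Children k m p} u∈)

      Child-complete : ∀ {k m p t} → Shaped k (suc m) p t ⊎ Shaped k m (suc p) t → Covered eqT (Children k m p) t
      Child-complete (inj₁ s) with u , u∈ , t≈u ← Enum-complete s = u , ∈-++⁺ˡ u∈ , t≈u
      Child-complete (inj₂ s) with u , u∈ , t≈u ← Enum-complete s = u , ∈-++⁺ʳ _ u∈ , t≈u

    length-Enum-suc : ∀ k m p → length (Enum (suc k) m p) ≤ length (labels m p) * 2 ^ length (Children k m p)
    length-Enum-suc k m p = length-concatMap-≤ _ (labels m p) _ λ {l} _ →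
      ≤-trans (≤-reflexive (length-map (node l) (sublists (Children k m p)))) (length-sublists (Children k m p))

    module Size (q Λ : ℕ) (few-labels : ∀ m p → m + p ≤ q → length (labels m p) ≤ Λ) where

      left : ∀ {m p k} → m + p + suc k ≤ q → suc m + p + k ≤ q
      left {m} {p} {k} h = ≤-trans (≤-reflexive (sym (+-suc (m + p) k))) h

      right : ∀ {m p k} → m + p + suc k ≤ q → m + suc p + k ≤ q
      right {m} {p} {k} h = ≤-trans (≤-reflexive (trans (cong (_+ k) (+-suc m p)) (sym (+-suc (m + p) k)))) h

      mutual
        length-Enum : ∀ k m p → m + p + k ≤ q → length (Enum k m p) ≤ U Λ k
        length-Enum zero    m p h = ≤-trans (≤-reflexive (length-map _ (labels m p)))
                                            (few-labels m p (≤-trans (≤-reflexive (sym (+-identityʳ (m + p)))) h))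
        length-Enum (suc k) m p h = ≤-trans (length-Enum-suc k m p)
          (*-mono-≤ (few-labels m p (m+n≤o⇒m≤o (m + p) h)) (^-monoʳ-≤ 2 (length-Children k m p h)))

        length-Children : ∀ k m p → m + p + suc k ≤ q → length (Children k m p) ≤ U Λ k + U Λ k
        length-Children k m p h = ≤-trans (≤-reflexive (length-++ (Enum k (suc m) p)))
          (+-mono-≤ (length-Enum k (suc m) p (left {m} {p} h)) (length-Enum k m (suc p) (right {m} {p} h)))

      nodes-Shaped : ∀ {k m p t} → Shaped k m p t → m + p + k ≤ q → nodes t ≤ W Λ k
      nodes-Shaped (leaf _) _ = ≤-refl
      nodes-Shaped {suc k} {m} {p} {node l ts} (inner _ distinct shaped) h = s≤s (begin
        nodesL ts                      ≤⟨ nodesL-≤ ts (W Λ k) (λ t∈ → nodes-child (shaped t∈)) ⟩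
        length ts * W Λ k              ≤⟨ *-monoˡ-≤ (W Λ k) (distinct-covered-≤ ts (Children k m p) distinct
                                                              (Child-complete ∘ shaped)) ⟩
        length (Children k m p) * W Λ k ≤⟨ *-monoˡ-≤ (W Λ k) (length-Children k m p h) ⟩
        (U Λ k + U Λ k) * W Λ k        ∎)
        where
        open ≤-Reasoning
        nodes-child : ∀ {t} → Shaped k (suc m) p t ⊎ Shaped k m (suc p) t → nodes t ≤ W Λ k
        nodes-child (inj₁ s) = nodes-Shaped s (left {m} {p} h)
        nodes-child (inj₂ s) = nodes-Shaped s (right {m} {p} h)

module _ {τ : Vocabulary} where
  open Labels τ
  open TreeOps (eqLabel τ)
  open Trees (eqLabel τ) eqLabel-sym eqLabel-trans
  open Enumeration allLabels

  rcFuel-Shaped : (𝒜 : Structure τ) (k : ℕ) {m p : ℕ} (c : Vec (Fin (n 𝒜)) m) (C : Vec (Subset (n 𝒜)) p)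
                → Shaped k m p (rcFuel 𝒜 k c C)
  rcFuel-Shaped 𝒜 zero    c C = leaf (allLabels-complete (ord 𝒜 c C))
  rcFuel-Shaped 𝒜 (suc k) {m} {p} c C =
    inner (allLabels-complete (ord 𝒜 c C)) (nubT-distinct (extensions ++ expansions)) child
    where
    extensions = map (λ d → rcFuel 𝒜 k (c ∷ʳ d) C) (allFin (n 𝒜))
    expansions = map (λ D → rcFuel 𝒜 k c (C ∷ʳ D)) (allSubsets (n 𝒜))
    child : ∀ {t} → t ∈ nubT (extensions ++ expansions) → Shaped k (suc m) p t ⊎ Shaped k m (suc p) t
    child t∈ with ∈-++⁻ extensions (nubT-⊆ (extensions ++ expansions) t∈)
    ... | inj₁ t∈₁ with d , _ , refl ← ∈-map⁻ _ t∈₁ = inj₁ (rcFuel-Shaped 𝒜 k (c ∷ʳ d) C)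
    ... | inj₂ t∈₂ with D , _ , refl ← ∈-map⁻ _ t∈₂ = inj₂ (rcFuel-Shaped 𝒜 k c (C ∷ʳ D))

n<2^n : ∀ n → n < 2 ^ n
n<2^n zero    = s≤s z≤n
n<2^n (suc n) = begin-strict
  suc n         ≡⟨ +-comm 1 n ⟩
  n + 1         <⟨ +-mono-<-≤ (n<2^n n) (m^n>0 2 n) ⟩
  2 ^ n + 2 ^ n ≡⟨ cong (2 ^ n +_) (sym (+-identityʳ (2 ^ n))) ⟩
  2 ^ suc n     ∎
  where open ≤-Reasoning

n≤2^n : ∀ n → n ≤ 2 ^ n
n≤2^n n = <⇒≤ (n<2^n n)

n+n≤2^n : ∀ n → n + n ≤ 2 ^ n
n+n≤2^n zero          = z≤n
n+n≤2^n (suc zero)    = ≤-refl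
n+n≤2^n (suc (suc n)) = begin
  suc (suc n) + suc (suc n) ≡⟨ regroup n ⟩
  (suc n + suc n) + 2       ≤⟨ +-mono-≤ (n+n≤2^n (suc n)) (≤-trans (s≤s (s≤s z≤n)) (n<2^n (suc n))) ⟩
  2 ^ suc n + 2 ^ suc n     ≡⟨ cong (2 ^ suc n +_) (sym (+-identityʳ (2 ^ suc n))) ⟩
  2 ^ suc (suc n)           ∎
  where
  open ≤-Reasoning
  regroup : ∀ n → suc (suc n) + suc (suc n) ≡ (suc n + suc n) + 2
  regroup = solve-∀

2*n≡n+n : ∀ n → 2 * n ≡ n + n
2*n≡n+n n = cong (n +_) (+-identityʳ n)

2^[2*n] : ∀ n → 2 ^ (2 * n) ≡ 2 ^ n * 2 ^ n
2^[2*n] n = trans (cong (2 ^_) (2*n≡n+n n)) (^-distribˡ-+-* 2 n n)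

square≤2^ : ∀ n → (n + n) * (n + n) ≤ 2 ^ (n + n)
square≤2^ n = ≤-trans (*-mono-≤ (n+n≤2^n n) (n+n≤2^n n)) (≤-reflexive (sym (^-distribˡ-+-* 2 n n)))

≤-*ˡ : ∀ {a} b → 1 ≤ a → b ≤ a * b
≤-*ˡ b 1≤a = ≤-trans (≤-reflexive (sym (*-identityˡ b))) (*-monoˡ-≤ b 1≤a)

step-mono : (f : ℕ → ℕ) → (∀ k → f k ≤ f (suc k)) → ∀ {k k′} → k ≤ k′ → f k ≤ f k′
step-mono f up {k} {k′} k≤k′ with m≤n⇒m<n∨m≡n k≤k′
... | inj₂ refl              = ≤-refl
... | inj₁ (s≤s {n = k″} lt) = ≤-trans (step-mono f up lt) (up k″)

expAbove-≥ : ∀ k y → y ≤ expAbove k y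
expAbove-≥ zero    y = ≤-refl
expAbove-≥ (suc k) y = ≤-trans (expAbove-≥ k y) (≤-trans (n≤2^n T) (^-monoʳ-≤ 2 (m≤n*m T 2)))
  where T = expAbove k y

module Growth (Λ : ℕ) (1≤Λ : 1 ≤ Λ) where

  U-up : ∀ k → U Λ k ≤ U Λ (suc k)
  U-up k = ≤-trans (m≤m+n (U Λ k) (U Λ k)) (≤-trans (n≤2^n _) (≤-*ˡ _ 1≤Λ))

  U-mono : ∀ {k k′} → k ≤ k′ → U Λ k ≤ U Λ k′
  U-mono = step-mono (U Λ) U-up

  Λ≤U : ∀ k → Λ ≤ U Λ k
  Λ≤U k = U-mono {0} {k} z≤n

  U-square : ∀ k → (U Λ k + U Λ k) * (U Λ k + U Λ k) ≤ U Λ (suc k)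
  U-square k = ≤-trans (square≤2^ (U Λ k)) (≤-*ˡ _ 1≤Λ)

  node-step : ∀ {u w} → 1 ≤ u → w ≤ u → suc ((u + u) * w) ≤ (u + u) * (u + u)
  node-step {u} {w} 1≤u w≤u = begin
    suc ((u + u) * w)         ≡⟨ +-comm 1 _ ⟩
    (u + u) * w + 1           ≤⟨ +-monoʳ-≤ ((u + u) * w) (*-mono-≤ (≤-trans 1≤u (m≤m+n u u)) 1≤u) ⟩
    (u + u) * w + (u + u) * u ≡⟨ sym (*-distribˡ-+ (u + u) w u) ⟩
    (u + u) * (w + u)         ≤⟨ *-monoʳ-≤ (u + u) (+-monoˡ-≤ u w≤u) ⟩
    (u + u) * (u + u)         ∎
    where open ≤-Reasoning

  mutual
    W≤U : ∀ k → W Λ k ≤ U Λ k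
    W≤U zero    = 1≤Λ
    W≤U (suc k) = ≤-trans (W-suc k) (U-square k)

    W-suc : ∀ k → W Λ (suc k) ≤ (U Λ k + U Λ k) * (U Λ k + U Λ k)
    W-suc k = node-step (≤-trans 1≤Λ (Λ≤U k)) (W≤U k)

  U-tower : ∀ y → Λ + Λ ≤ y → ∀ k → U Λ k + U Λ k ≤ expAbove k y
  U-tower y 2Λ≤y zero    = 2Λ≤y
  U-tower y 2Λ≤y (suc k) = begin
    Λ * X + Λ * X ≡⟨ sym (*-distribʳ-+ X Λ Λ) ⟩
    (Λ + Λ) * X   ≤⟨ *-mono-≤ (≤-trans 2Λ≤2U (≤-trans ih (n≤2^n T))) (^-monoʳ-≤ 2 ih) ⟩
    2 ^ T * 2 ^ T ≡⟨ sym (2^[2*n] T) ⟩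
    2 ^ (2 * T)   ∎
    where
    open ≤-Reasoning
    X = 2 ^ (U Λ k + U Λ k)
    T = expAbove k y
    ih = U-tower y 2Λ≤y k
    2Λ≤2U : Λ + Λ ≤ U Λ k + U Λ k
    2Λ≤2U = +-mono-≤ (Λ≤U k) (Λ≤U k)

square≤^4 : ∀ {u T} → u ≤ T → 2 ≤ T → (u + u) * (u + u) ≤ T ^ 4
square≤^4 {u} {T} u≤T 2≤T = begin
  (u + u) * (u + u) ≤⟨ *-mono-≤ 2u≤T² 2u≤T² ⟩
  (T * T) * (T * T) ≡⟨ fourth T ⟩
  T ^ 4             ∎
  where
  open ≤-Reasoning
  2u≤T² : u + u ≤ T * T
  2u≤T² = ≤-trans (+-mono-≤ u≤T u≤T) (≤-trans (≤-reflexive (sym (2*n≡n+n T))) (*-monoˡ-≤ T 2≤T))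
  fourth : ∀ T → (T * T) * (T * T) ≡ T * (T * (T * (T * 1)))
  fourth = solve-∀

count-one : ∀ {X a b c} → 1 ≤ X → a ≤ X → b ≤ X + X → c ≤ X → a * 2 ^ (b + c) + (c + b) ≤ 2 ^ (2 * (X + X))
count-one {X} {a} {b} {c} 1≤X a≤X b≤2X c≤X = begin
  a * 2 ^ (b + c) + (c + b) ≤⟨ +-mono-≤ (*-mono-≤ a≤X (^-monoʳ-≤ 2 b+c≤Y))
                                         (≤-trans (≤-reflexive (+-comm c b)) (≤-trans b+c≤Y (n≤2^n Y))) ⟩
  X * 2 ^ Y + 2 ^ Y         ≡⟨ cong (X * 2 ^ Y +_) (sym (*-identityˡ (2 ^ Y))) ⟩
  X * 2 ^ Y + 1 * 2 ^ Y     ≡⟨ sym (*-distribʳ-+ (2 ^ Y) X 1) ⟩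
  (X + 1) * 2 ^ Y           ≤⟨ *-monoˡ-≤ (2 ^ Y) (≤-trans (≤-reflexive (+-comm X 1)) (n<2^n X)) ⟩
  2 ^ X * 2 ^ Y             ≡⟨ sym (^-distribˡ-+-* 2 X Y) ⟩
  2 ^ (X + Y)               ≡⟨ cong (2 ^_) (regroup X) ⟩
  2 ^ (2 * (X + X))         ∎
  where
  open ≤-Reasoning
  Y = (X + X) + X
  b+c≤Y : b + c ≤ Y
  b+c≤Y = +-mono-≤ b≤2X c≤X
  regroup : ∀ X → X + ((X + X) + X) ≡ 2 * (X + X)
  regroup = solve-∀

count-many : ∀ {a Λ u T} → a * a ≤ Λ → u + u ≤ T → Λ + Λ ≤ T → a * (a * (Λ * 2 ^ (u + u))) ≤ 2 ^ (2 * T)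
count-many {a} {Λ} {u} {T} a²≤Λ 2u≤T 2Λ≤T = begin
  a * (a * (Λ * 2 ^ (u + u))) ≡⟨ sym (*-assoc a a _) ⟩
  (a * a) * (Λ * 2 ^ (u + u)) ≤⟨ *-mono-≤ (≤-trans a²≤Λ (n≤2^n Λ))
                                          (*-mono-≤ (n≤2^n Λ) (^-monoʳ-≤ 2 2u≤T)) ⟩
  2 ^ Λ * (2 ^ Λ * 2 ^ T)     ≡⟨ sym (*-assoc (2 ^ Λ) _ _) ⟩
  (2 ^ Λ * 2 ^ Λ) * 2 ^ T     ≡⟨ cong (_* 2 ^ T) (sym (^-distribˡ-+-* 2 Λ Λ)) ⟩
  2 ^ (Λ + Λ) * 2 ^ T         ≤⟨ *-monoˡ-≤ (2 ^ T) (^-monoʳ-≤ 2 2Λ≤T) ⟩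
  2 ^ T * 2 ^ T               ≡⟨ sym (2^[2*n] T) ⟩
  2 ^ (2 * T)                 ∎
  where open ≤-Reasoning

-- The setting of the theorem: τ has arities at most r, and q = q′ + 1.
-- Λ = 2^(|τ|·q^r + q²) bounds the number of labels at every level,
-- y = twoToX = 2^x, and T = exp⁽q⁾(x) = expAbove q′ y.

module Setting (τ : Vocabulary) (r : ℕ) (arity≤r : MaxArity≤ τ r) (q′ : ℕ) where
  open Labels τ public
  open TreeOps (eqLabel τ) public
  open Trees (eqLabel τ) eqLabel-sym eqLabel-trans public
  open Enumeration allLabels public

  q Λ y T : ℕ
  q = suc q′
  Λ = 2 ^ (size τ * q ^ r + q * q)
  y = twoToX (size τ) q r
  T = expAbove q′ y

  few-labels : ∀ m p → m + p ≤ q → length (allLabels m p) ≤ Λ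
  few-labels m p m+p≤q = ≤-trans (length-allLabels m p (q ^ r) tuples≤) (^-monoʳ-≤ 2 exponent≤)
    where
    m≤q = m+n≤o⇒m≤o m m+p≤q
    tuples≤ : ∀ R → m ^ arity τ R ≤ q ^ r
    tuples≤ R = ≤-trans (^-monoˡ-≤ (arity τ R) m≤q) (^-monoʳ-≤ q (arity≤r R))
    regroup : ∀ m p Q s → m * m + (Q * s + m * p) ≡ s * Q + m * (m + p)
    regroup = solve-∀
    exponent≤ : m * m + (q ^ r * size τ + m * p) ≤ size τ * q ^ r + q * q
    exponent≤ = ≤-trans (≤-reflexive (regroup m p (q ^ r) (size τ)))
                        (+-monoʳ-≤ (size τ * q ^ r) (*-mono-≤ m≤q m+p≤q))

  open Size q Λ few-labels public

  1≤Λ : 1 ≤ Λ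
  1≤Λ = m^n>0 2 (size τ * q ^ r + q * q)

  open Growth Λ 1≤Λ public

  Λ≤y : Λ ≤ y
  Λ≤y = ≤-trans (≤-reflexive (sym (*-identityʳ Λ))) (*-monoʳ-≤ Λ (m^n>0 q q))

  y≤T : y ≤ T
  y≤T = expAbove-≥ q′ y

  2≤T : 2 ≤ T
  2≤T = ≤-trans 2≤Λ (≤-trans Λ≤y y≤T)
    where
    2≤Λ : 2 ≤ Λ
    2≤Λ = ^-monoʳ-≤ 2 {1} (≤-trans (s≤s z≤n) (m≤n+m (q * q) (size τ * q ^ r)))

  -- for q ≥ 2 the tower starts above 2Λ, since q^q ≥ 2
  2Λ≤y : 2 ≤ q → Λ + Λ ≤ y
  2Λ≤y 2≤q = ≤-trans (≤-reflexive (trans (sym (2*n≡n+n Λ)) (*-comm 2 Λ))) (*-monoʳ-≤ Λ (≤-trans 2≤q q≤q^q))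
    where
    q≤q^q : q ≤ q ^ q
    q≤q^q = ≤-trans (≤-reflexive (sym (*-identityʳ q))) (*-monoʳ-≤ q (m^n>0 q q′))

  levels≤Λ : 2 ≤ q → suc q * suc q ≤ Λ
  levels≤Λ 2≤q = begin
    suc q * suc q ≤⟨ *-mono-≤ (n<2^n q) (n<2^n q) ⟩
    2 ^ q * 2 ^ q ≡⟨ sym (^-distribˡ-+-* 2 q q) ⟩
    2 ^ (q + q)   ≤⟨ ^-monoʳ-≤ 2 (≤-trans (≤-reflexive (sym (2*n≡n+n q))) (*-monoˡ-≤ q 2≤q)) ⟩
    2 ^ (q * q)   ≤⟨ ^-monoʳ-≤ 2 (m≤n+m (q * q) (size τ * q ^ r)) ⟩
    Λ             ∎
    where open ≤-Reasoning

  level : ℕ → ℕ → List (Tree (Label τ))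
  level m p = Enum (q ∸ (m + p)) m p

  row : ℕ → List (Tree (Label τ))
  row m = concatMap (level m) (upTo (suc q ∸ m))

  L : List (Tree (Label τ))
  L = concatMap row (upTo (suc q))

  L-complete : (𝒜 : Structure τ) (m p : ℕ) → m + p ≤ q → (c : Vec (Fin (n 𝒜)) m) (C : Vec (Subset (n 𝒜)) p)
             → mem (RC 𝒜 q c C) L ≡ true
  L-complete 𝒜 m p m+p≤q c C
    with u , u∈ , rc≈u ← Enum-complete (rcFuel-Shaped 𝒜 (q ∸ (m + p)) c C) =
    mem-complete _ (∈-concatMap row (∈-concatMap (level m) u∈ p∈) m∈) rc≈u
    where
    m∈ : m ∈ upTo (suc q)
    m∈ = ∈-upTo⁺ (s≤s (m+n≤o⇒m≤o m m+p≤q))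
    p∈ : p ∈ upTo (suc q ∸ m)
    p∈ = ∈-upTo⁺ (m+n≤o⇒m≤o∸n (suc p) (s≤s (≤-trans (≤-reflexive (+-comm p m)) m+p≤q)))

  pair-bound : ∀ {m p} → m < suc q → p < suc q ∸ m → m + p ≤ q
  pair-bound {m} {p} m<1+q p<1+q-m = ≤-pred (begin
    suc (m + p)       ≡⟨ sym (+-suc m p) ⟩
    m + suc p         ≤⟨ +-monoʳ-≤ m p<1+q-m ⟩
    m + (suc q ∸ m)   ≡⟨ m+[n∸m]≡n (<⇒≤ m<1+q) ⟩
    suc q             ∎)
    where open ≤-Reasoning

  length-L-≤ : length L ≤ suc q * (suc q * U Λ q)
  length-L-≤ = ≤-trans
    (length-concatMap-≤ row (upTo (suc q)) (suc q * U Λ q) λ {m} m∈ →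
       ≤-trans (length-concatMap-≤ (level m) (upTo (suc q ∸ m)) (U Λ q) λ p∈ →
                  level-bound {m} (pair-bound (∈-upTo⁻ m∈) (∈-upTo⁻ p∈)))
               (*-monoˡ-≤ (U Λ q) (≤-trans (≤-reflexive (length-upTo (suc q ∸ m))) (m∸n≤m (suc q) m))))
    (≤-reflexive (cong (_* (suc q * U Λ q)) (length-upTo (suc q))))
    where
    level-bound : ∀ {m p} → m + p ≤ q → length (level m p) ≤ U Λ q
    level-bound {m} {p} m+p≤q = ≤-trans (length-Enum (q ∸ (m + p)) m p (≤-reflexive (m+[n∸m]≡n m+p≤q)))
                                        (U-mono (m∸n≤m q (m + p)))

twoToX-one : ∀ s r → twoToX s 1 r ≡ 2 ^ s + 2 ^ s
twoToX-one s r = begin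
  2 ^ (s * 1 ^ r + 1) * 1 ≡⟨ *-identityʳ _ ⟩
  2 ^ (s * 1 ^ r + 1)     ≡⟨ cong (λ k → 2 ^ (s * k + 1)) (^-zeroˡ r) ⟩
  2 ^ (s * 1 + 1)         ≡⟨ cong (2 ^_) (trans (+-comm _ 1) (cong suc (*-identityʳ s))) ⟩
  2 ^ s + (2 ^ s + 0)     ≡⟨ cong (2 ^ s +_) (+-identityʳ (2 ^ s)) ⟩
  2 ^ s + 2 ^ s           ∎
  where open ≡-Reasoning

U≤T : ∀ τ r arity≤r q′ → let open Setting τ r arity≤r q′ in U Λ q′ ≤ T
U≤T τ r arity≤r zero     = Λ≤y
  where open Setting τ r arity≤r zero
U≤T τ r arity≤r (suc q″) = ≤-trans (m≤m+n _ _) (U-tower y (2Λ≤y (s≤s (s≤s z≤n))) (suc q″))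
  where open Setting τ r arity≤r (suc q″)

fuel-spent : ∀ {q j k} → q ∸ j ≡ suc k → j + suc k ≡ q
fuel-spent {q} {j} fuel = trans (cong (j +_) (sym fuel))
  (m+[n∸m]≡n {j} (<⇒≤ (m∸n≢0⇒n<m λ q∸j≡0 → 0≢1+n (trans (sym q∸j≡0) fuel))))

nodes-RC : ∀ τ r arity≤r q′ (𝒜 : Structure τ) (m p : ℕ) (c : Vec (Fin (n 𝒜)) m) (C : Vec (Subset (n 𝒜)) p)
         → let open Setting τ r arity≤r q′ in nodes (RC 𝒜 q c C) ≤ T ^ 4
nodes-RC τ r arity≤r q′ 𝒜 m p c C with suc q′ ∸ (m + p) in fuel
... | zero  = ^-monoˡ-≤ 4 (≤-trans (s≤s z≤n) 2≤T)
  where open Setting τ r arity≤r q′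
... | suc k = begin
  nodes (rcFuel 𝒜 (suc k) c C)  ≤⟨ nodes-Shaped (rcFuel-Shaped 𝒜 (suc k) c C) (≤-reflexive (fuel-spent fuel)) ⟩
  W Λ (suc k)                   ≤⟨ W-suc k ⟩
  (U Λ k + U Λ k) * (U Λ k + U Λ k) ≤⟨ square≤^4 (≤-trans (U-mono k≤q′) (U≤T τ r arity≤r q′)) 2≤T ⟩
  T ^ 4                         ∎
  where
  open Setting τ r arity≤r q′
  open ≤-Reasoning
  k≤q′ : k ≤ q′
  k≤q′ = ≤-pred (≤-trans (≤-reflexive (sym fuel)) (m∸n≤m q (m + p)))

length-L : ∀ τ r arity≤r q′ → let open Setting τ r arity≤r q′ in length L ≤ expAbove q y
length-L τ r arity≤r zero = begin
  length L                                            ≡⟨ layout ⟩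
  length (Enum 1 0 0) + (c + b)                       ≤⟨ +-monoˡ-≤ (c + b) (length-Enum-suc 0 0 0) ⟩
  a * 2 ^ length (Enum 0 1 0 ++ Enum 0 0 1) + (c + b) ≡⟨ cong (λ k → a * 2 ^ k + (c + b)) (length-++ (Enum 0 1 0)) ⟩
  a * 2 ^ (b + c) + (c + b)                           ≤⟨ count-one (m^n>0 2 (size τ)) a≤X b≤2X c≤X ⟩
  2 ^ (2 * (X + X))                                   ≡⟨ cong (λ k → 2 ^ (2 * k)) (sym (twoToX-one (size τ) r)) ⟩
  expAbove 1 y                                        ∎
  where
  open Setting τ r arity≤r zero
  open ≤-Reasoning
  X = 2 ^ size τ
  a = length (allLabels 0 0)
  b = length (Enum 0 1 0)
  c = length (Enum 0 0 1)
  -- for q = 1, L lists the level (0 , 0) of depth 1 and the levels (0 , 1), (1 , 0) of depth 0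
  regroup : ∀ a b c → (a + (b + 0)) + ((c + 0) + 0) ≡ a + (b + c)
  regroup = solve-∀
  layout : length L ≡ length (Enum 1 0 0) + (c + b)
  layout = trans (length-concatMap row (upTo 2))
             (trans (cong₂ (λ x z → x + (z + 0)) (length-concatMap (level 0) (upTo 2))
                                                  (length-concatMap (level 1) (upTo 1)))
                    (regroup (length (Enum 1 0 0)) c b))
  a≤X : a ≤ X
  a≤X = length-allLabels-≤1 0 0 z≤n
  b≤2X : b ≤ X + X
  b≤2X = ≤-trans (≤-reflexive (length-map _ (allLabels 1 0)))
           (≤-trans (length-allLabels-≤1 1 0 ≤-refl) (≤-reflexive (cong (X +_) (+-identityʳ X))))
  c≤X : c ≤ X
  c≤X = ≤-trans (≤-reflexive (length-map _ (allLabels 0 1))) (length-allLabels-≤1 0 1 ≤-refl)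
length-L τ r arity≤r (suc q″) =
  ≤-trans length-L-≤
    (count-many {u = U Λ (suc q″)} (levels≤Λ 2≤q) (U-tower y (2Λ≤y 2≤q) (suc q″)) (≤-trans (2Λ≤y 2≤q) y≤T))
  where
  open Setting τ r arity≤r (suc q″)
  2≤q : 2 ≤ q
  2≤q = s≤s (s≤s z≤n)

lemma4 : (τ : Vocabulary) (r : ℕ) → MaxArity≤ τ r → (𝒜 : Structure τ)
    → (q : ℕ) → 1 ≤ q
    → Σ (List (Tree (Label τ))) (λ L →
          length L ≤ expAbove q (twoToX (size τ) q r)
          × ((m p : ℕ) → m + p ≤ q
             → (c : Vec (Fin (n 𝒜)) m) (C : Vec (Subset (n 𝒜)) p)
             → TreeOps.mem (eqLabel τ) (RC 𝒜 q c C) L ≡ true))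
      × ((m p : ℕ) (c : Vec (Fin (n 𝒜)) m) (C : Vec (Subset (n 𝒜)) p)
         → TreeOps.nodes (eqLabel τ) (RC 𝒜 q c C)
           ≤ expAbove (q ∸ 1) (twoToX (size τ) q r) ^ 4)
lemma4 τ r arity≤r 𝒜 (suc q′) _ =
  (L , length-L τ r arity≤r q′ , L-complete 𝒜) , nodes-RC τ r arity≤r q′ 𝒜
  where open Setting τ r arity≤r q′
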